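{- Let $\gamma\in(0,1)$ and let $X_0\to Y_0,\ldots,X_k\to Y_k$ be partial implications on $[n]$ with $k\ge1$. If $\gamma<1/k$, then the following are equivalent: 1. $X_1\to Y_1,\ldots,X_k\to Y_k\models_\gamma X_0\to Y_0$; 2. $X_i\to Y_i\models_\gamma X_0\to Y_0$ for some $i\in[k]$; 3. either $Y_0\subseteq X_0$, or $X_i\subseteq X_0$ and $X_0Y_0\subseteq X_iY_i$ for some $i\in[k]$.
   Context: Attributes are the elements of $[n]$; a transaction is a subset of $[n]$; a data-set $\mathcal D$ is a finite multiset of transactions; $\mathrm{C}_{\mathcal D}[X]$ is the number of transactions of $\mathcal D$ containing $X$, counted with multiplicity. A partial implication $X\to Y$ is a pair of subsets of $[n]$; $XY$ denotes $X\cup Y$. $\mathcal D\models_\gamma X\to Y$ means $\mathrm{C}_{\mathcal D}[X]=0$ or $\mathrm{C}_{\mathcal D}[XY]/\mathrm{C}_{\mathcal D}[X]\ge\gamma$. $X_1\to Y_1,\ldots,X_k\to Y_k\models_\gamma X_0\to Y_0$ means every data-set on $[n]$ satisfying all $X_i\to Y_i$ ($i\in[k]$) at $\gamma$ also satisfies $X_0\to Y_0$ at $\gamma$.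
   Formalization: The parameter γ ranges over the rationals in (0,1) instead of the reals. -}

module Defs where

open import Data.Nat using (ℕ)
open import Data.Fin using (Fin)
open import Data.Fin.Subset using (Subset; _⊆_; _∪_)
open import Data.Fin.Subset.Properties using (_⊆?_)
open import Data.List using (List; length; filter)
open import Data.Integer using (+_)
open import Data.Rational using (ℚ; _/_; _*_; _≤_)
open import Data.Sum using (_⊎_)

-- A transaction is a subset of [n]; a data-set is a finite multiset of
-- transactions, represented as a list (order irrelevant to all notions below).
Transaction : ℕ → Set
Transaction n = Subset n

DataSet : ℕ → Set
DataSet n = List (Transaction n)

C : {n : ℕ} → DataSet n → Subset n → ℕ
C D X = length (filter (X ⊆?_) D)

ℕ→ℚ : ℕ → ℚ
ℕ→ℚ m = + m / 1

record PImp (n : ℕ) : Set where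
  constructor _⇒_
  field
    lhs : Subset n
    rhs : Subset n
open PImp public

-- D ⊨_γ X → Y  :  C[X] = 0  or  C[XY]/C[X] ≥ γ.
-- For C[X] > 0 the ratio condition is equivalent to γ·C[X] ≤ C[XY]; for
-- C[X] = 0 the latter holds trivially, so this single inequality is exactly
-- the disjunction of the paper.
_⊨[_]_ : {n : ℕ} → DataSet n → ℚ → PImp n → Set
D ⊨[ γ ] (X ⇒ Y) = γ * ℕ→ℚ (C D X) ≤ ℕ→ℚ (C D (X ∪ Y))

_⊩[_]_ : {n k : ℕ} → (Fin k → PImp n) → ℚ → PImp n → Set
_⊩[_]_ {n} {k} P γ Q =
  (D : DataSet n) → ((i : Fin k) → D ⊨[ γ ] P i) → D ⊨[ γ ] Q

{-# OPTIONS --safe #-}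
module Submission where

-- If X₀ → Y₀ is trivial, or some premise Xᵢ → Yᵢ has Xᵢ ⊆ X₀ and X₀Y₀ ⊆ XᵢYᵢ,
-- then C[X₀] ≤ C[Xᵢ] and C[XᵢYᵢ] ≤ C[X₀Y₀], so that premise alone entails
-- X₀ → Y₀. Otherwise a single data-set refutes the entailment: w copies of X₀,
-- u copies of [n], and for each premise y copies of a transaction Tᵢ that
-- misses X₀Y₀ but contains XᵢYᵢ whenever Xᵢ ⊆ X₀. Only the u full transactions
-- support the conclusion, a premise with Xᵢ ⊈ X₀ never sees the copies of X₀,
-- and a premise with Xᵢ ⊆ X₀ is supported by its own block. With w chosen so
-- that γ(w + u) exceeds u only barely, γk < 1 leaves room for the k blocks.

open import Defs
open import Data.Nat using (ℕ; suc)
open import Data.Fin using (Fin; zero; suc)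
open import Data.Fin.Subset using (Subset; _⊆_; _∪_; ⊤)
open import Data.Rational using (ℚ; 0ℚ; 1ℚ; _<_; _*_)
open import Data.Product using (Σ; _×_; _,_; proj₁; proj₂)
open import Data.Sum using (_⊎_; inj₁; inj₂; [_,_])
open import Function.Bundles using (_⇔_; mk⇔; Equivalence)

open import Data.Empty using (⊥-elim)
open import Data.Fin.Properties using (any?)
open import Data.Fin.Subset.Properties using (_⊆?_; ⊆⊤; ⊆-trans; q⊆p∪q; x∈p∪q⁻)
open import Data.Integer as ℤ using (+_; -[1+_]; +<+)
import Data.Integer.Properties as ℤ
open import Data.List using ([]; _++_; replicate; length; filter)
open import Data.List.Properties
  using (length-++; length-replicate; length-filter; filter-++; filter-all; filter-none)
open import Data.List.Relation.Binary.Sublist.Propositional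
  using () renaming (_⊆_ to _⊑_; ⊆-refl to ⊑-refl)
open import Data.List.Relation.Binary.Sublist.Propositional.Properties
  using (filter⁺; length-mono-≤; ++⁺ˡ; ++⁺ʳ)
open import Data.List.Relation.Unary.All using (All; [])
import Data.List.Relation.Unary.All.Properties as All
open import Data.Nat as ℕ using (z<s)
open import Data.Nat.Coprimality using (Coprime; 1-coprimeTo)
import Data.Nat.Coprimality as Coprimality
open import Data.Nat.Properties
  using (≤-refl; ≤-trans; ≤-reflexive; <⇒≤; <⇒≱; ≤-<-trans; m≤m+n; m≤n+m; m<m+n; m≤m*n;
         +-monoʳ-≤; +-mono-≤; *-monoʳ-≤; *-monoˡ-≤; *-comm; *-identityˡ; *-identityʳ;
         +-identityʳ; *-distribʳ-+; m≤n⇒∃[o]m+o≡n; module ≤-Reasoning)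
open import Data.Nat.Tactic.RingSolver using (solve-∀)
open import Data.Rational as ℚ using (mkℚ; toℚᵘ; *<*)
open import Data.Rational.Properties
  using (normalize-coprime; toℚᵘ-homo-*; toℚᵘ-mono-≤; toℚᵘ-cancel-≤; toℚᵘ-mono-<)
open import Data.Rational.Unnormalised as ℚᵘ using (mkℚᵘ; *≤*)
import Data.Rational.Unnormalised.Properties as ℚᵘ
open import Function.Base using (id; _∘_; _$_)
open import Relation.Binary.PropositionalEquality
  using (_≡_; refl; sym; trans; cong; cong₂; subst; subst₂; module ≡-Reasoning)
open import Relation.Nullary using (¬_; Dec; yes; no)
open import Relation.Nullary.Decidable using (_×-dec_; _⊎-dec_; decidable-stable)

ℕ→ℚ≡mkℚ : ∀ a → ℕ→ℚ a ≡ mkℚ (+ a) 0 (Coprimality.sym (1-coprimeTo a))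
ℕ→ℚ≡mkℚ a = normalize-coprime _

toℚᵘ-ℕ→ℚ : ∀ a → toℚᵘ (ℕ→ℚ a) ℚᵘ.≃ mkℚᵘ (+ a) 0
toℚᵘ-ℕ→ℚ a = ℚᵘ.≃-reflexive (cong toℚᵘ (ℕ→ℚ≡mkℚ a))

toℚᵘ-mkℚ*ℕ→ℚ : ∀ p d .(c : Coprime p (suc d)) a →
  toℚᵘ (mkℚ (+ p) d c * ℕ→ℚ a) ℚᵘ.≃ mkℚᵘ (+ (p ℕ.* a)) d
toℚᵘ-mkℚ*ℕ→ℚ p d c a rewrite ℕ→ℚ≡mkℚ a =
  ℚᵘ.≃-trans (toℚᵘ-homo-* (mkℚ (+ p) d c) (mkℚ (+ a) 0 (Coprimality.sym (1-coprimeTo a))))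
    (ℚᵘ.*≡* (cong₂ ℤ._*_ (ℤ.+◃n≡+n (p ℕ.* a)) (cong (λ e → + suc e) (sym (*-identityʳ d)))))

module _ (x d b : ℕ) where

  private
    x*1≡x : + x ℤ.* + 1 ≡ + x
    x*1≡x = ℤ.*-identityʳ (+ x)

    +b*+q≡+[b*q] : + b ℤ.* + suc d ≡ + (b ℕ.* suc d)
    +b*+q≡+[b*q] = sym (ℤ.pos-* b (suc d))

  mkℚᵘ-≤⇔ : mkℚᵘ (+ x) d ℚᵘ.≤ mkℚᵘ (+ b) 0 ⇔ x ℕ.≤ b ℕ.* suc d
  mkℚᵘ-≤⇔ = mk⇔
    (λ { (*≤* x≤b) → ℤ.drop‿+≤+ (subst₂ ℤ._≤_ x*1≡x +b*+q≡+[b*q] x≤b) })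
    (λ x≤b → *≤* (subst₂ ℤ._≤_ (sym x*1≡x) (sym +b*+q≡+[b*q]) (ℤ.+≤+ x≤b)))

  mkℚᵘ-<⇒ : mkℚᵘ (+ x) d ℚᵘ.< mkℚᵘ (+ b) 0 → x ℕ.< b ℕ.* suc d
  mkℚᵘ-<⇒ (ℚᵘ.*<* x<b) = ℤ.drop‿+<+ (subst₂ ℤ._<_ x*1≡x +b*+q≡+[b*q] x<b)

module _ (p d : ℕ) .(c : Coprime p (suc d)) (a b : ℕ) where

  mkℚ*ℕ→ℚ-≤⇔ : mkℚ (+ p) d c * ℕ→ℚ a ℚ.≤ ℕ→ℚ b ⇔ p ℕ.* a ℕ.≤ b ℕ.* suc d
  mkℚ*ℕ→ℚ-≤⇔ = mk⇔
    (λ γa≤b → Equivalence.to (mkℚᵘ-≤⇔ (p ℕ.* a) d b)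
      (ℚᵘ.≤-respˡ-≃ (toℚᵘ-mkℚ*ℕ→ℚ p d c a) (ℚᵘ.≤-respʳ-≃ (toℚᵘ-ℕ→ℚ b) (toℚᵘ-mono-≤ γa≤b))))
    (λ pa≤bq → toℚᵘ-cancel-≤
      (ℚᵘ.≤-respˡ-≃ (ℚᵘ.≃-sym (toℚᵘ-mkℚ*ℕ→ℚ p d c a)) (ℚᵘ.≤-respʳ-≃ (ℚᵘ.≃-sym (toℚᵘ-ℕ→ℚ b))
        (Equivalence.from (mkℚᵘ-≤⇔ (p ℕ.* a) d b) pa≤bq))))

  mkℚ*ℕ→ℚ-<⇒ : mkℚ (+ p) d c * ℕ→ℚ a < ℕ→ℚ b → p ℕ.* a ℕ.< b ℕ.* suc d
  mkℚ*ℕ→ℚ-<⇒ γa<b = mkℚᵘ-<⇒ (p ℕ.* a) d b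
    (ℚᵘ.<-respˡ-≃ (toℚᵘ-mkℚ*ℕ→ℚ p d c a) (ℚᵘ.<-respʳ-≃ (toℚᵘ-ℕ→ℚ b) (toℚᵘ-mono-< γa<b)))

record _⊨⟨_/_⟩_ {n : ℕ} (D : DataSet n) (p q : ℕ) (I : PImp n) : Set where
  constructor cross-multiplied
  field
    cross-≤ : p ℕ.* C D (lhs I) ℕ.≤ C D (lhs I ∪ rhs I) ℕ.* q

⊨⇔⊨⟨⟩ : ∀ {n} p d .(c : Coprime p (suc d)) {D : DataSet n} {I : PImp n} →
  D ⊨[ mkℚ (+ p) d c ] I ⇔ D ⊨⟨ p / suc d ⟩ I
⊨⇔⊨⟨⟩ p d c {D} {I} = mk⇔ (cross-multiplied ∘ to) (from ∘ _⊨⟨_/_⟩_.cross-≤)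
  where open Equivalence (mkℚ*ℕ→ℚ-≤⇔ p d c (C D (lhs I)) (C D (lhs I ∪ rhs I)))

module _ {n : ℕ} where

  C-++ : ∀ (D E : DataSet n) X → C (D ++ E) X ≡ C D X ℕ.+ C E X
  C-++ D E X = trans (cong length (filter-++ (X ⊆?_) D E)) (length-++ (filter (X ⊆?_) D))

  C≤length : ∀ (D : DataSet n) X → C D X ℕ.≤ length D
  C≤length D X = length-filter (X ⊆?_) D

  C-none : ∀ {D : DataSet n} {X} → All (λ t → ¬ X ⊆ t) D → C D X ≡ 0
  C-none {X = X} none = cong length (filter-none (X ⊆?_) none)

  C-replicate : ∀ r {t X : Subset n} → X ⊆ t → C (replicate r t) X ≡ r
  C-replicate r {X = X} X⊆t =
    trans (cong length (filter-all (X ⊆?_) (All.replicate⁺ r X⊆t))) (length-replicate r)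

  C-mono : ∀ {D E : DataSet n} {X X′} → D ⊑ E → X ⊆ X′ → C D X′ ℕ.≤ C E X
  C-mono {X = X} {X′} D⊑E X⊆X′ =
    length-mono-≤ (filter⁺ (X′ ⊆?_) (X ⊆?_) (λ { refl X′⊆t → ⊆-trans X⊆X′ X′⊆t }) D⊑E)

  C-antitone : ∀ (D : DataSet n) {X X′} → X ⊆ X′ → C D X′ ℕ.≤ C D X
  C-antitone D = C-mono {D = D} ⊑-refl

  blocks : ∀ {m} → ℕ → (Fin m → Subset n) → DataSet n
  blocks {ℕ.zero} y T = []
  blocks {ℕ.suc m} y T = replicate y (T zero) ++ blocks y (T ∘ suc)

  length-blocks : ∀ {m} y (T : Fin m → Subset n) → length (blocks y T) ≡ m ℕ.* y
  length-blocks {ℕ.zero} y T = refl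
  length-blocks {ℕ.suc m} y T =
    trans (length-++ (replicate y (T zero)))
          (cong₂ ℕ._+_ (length-replicate y) (length-blocks y (T ∘ suc)))

  All-blocks : ∀ {m} {P : Subset n → Set} y (T : Fin m → Subset n) →
    (∀ i → P (T i)) → All P (blocks y T)
  All-blocks {ℕ.zero} y T PT = []
  All-blocks {ℕ.suc m} y T PT =
    All.++⁺ (All.replicate⁺ y (PT zero)) (All-blocks y (T ∘ suc) (PT ∘ suc))

  replicate⊑blocks : ∀ {m} y (T : Fin m → Subset n) i → replicate y (T i) ⊑ blocks y T
  replicate⊑blocks y T zero    = ++⁺ʳ (blocks y (T ∘ suc)) ⊑-refl
  replicate⊑blocks y T (suc i) = ++⁺ˡ (replicate y (T zero)) (replicate⊑blocks y (T ∘ suc) i)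

  C-blocks : ∀ {m} y (T : Fin m → Subset n) X i → X ⊆ T i → y ℕ.≤ C (blocks y T) X
  C-blocks y T X i X⊆Tᵢ =
    subst (ℕ._≤ C (blocks y T) X) (C-replicate y X⊆Tᵢ) (C-mono (replicate⊑blocks y T i) id)

⊨⟨⟩-bounds : ∀ {n p q a b} {D : DataSet n} {I : PImp n} →
  C D (lhs I) ℕ.≤ a → p ℕ.* a ℕ.≤ b ℕ.* q → b ℕ.≤ C D (lhs I ∪ rhs I) → D ⊨⟨ p / q ⟩ I
⊨⟨⟩-bounds {p = p} {q} lhs≤a pa≤bq b≤lhs∪rhs = cross-multiplied $
  ≤-trans (*-monoʳ-≤ p lhs≤a) (≤-trans pa≤bq (*-monoˡ-≤ q b≤lhs∪rhs))

Trivial : {n : ℕ} → PImp n → Set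
Trivial I = rhs I ⊆ lhs I

Subsumes : {n : ℕ} → PImp n → PImp n → Set
Subsumes I J = lhs I ⊆ lhs J × (lhs J ∪ rhs J) ⊆ (lhs I ∪ rhs I)

Subsumed : {n k : ℕ} → (Fin k → PImp n) → PImp n → Set
Subsumed {k = k} P J = Trivial J ⊎ Σ (Fin k) λ i → Subsumes (P i) J

subsumed? : ∀ {n k} (P : Fin k → PImp n) J → Dec (Subsumed P J)
subsumed? P J = (rhs J ⊆? lhs J)
  ⊎-dec any? (λ i → (lhs (P i) ⊆? lhs J) ×-dec ((lhs J ∪ rhs J) ⊆? (lhs (P i) ∪ rhs (P i))))

module _ {n p q : ℕ} {D : DataSet n} where

  ⊨⟨⟩-trivial : ∀ {J} → p ℕ.≤ q → Trivial J → D ⊨⟨ p / q ⟩ J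
  ⊨⟨⟩-trivial {J} p≤q Y⊆X = ⊨⟨⟩-bounds ≤-refl
    (≤-trans (*-monoˡ-≤ (C D (lhs J)) p≤q) (≤-reflexive (*-comm q (C D (lhs J)))))
    (C-antitone D (λ x∈X∪Y → [ id , Y⊆X ] (x∈p∪q⁻ (lhs J) (rhs J) x∈X∪Y)))

  ⊨⟨⟩-subsumes : ∀ {I J} → Subsumes I J → D ⊨⟨ p / q ⟩ I → D ⊨⟨ p / q ⟩ J
  ⊨⟨⟩-subsumes {I} {J} (lhsI⊆lhsJ , J⊆I) (cross-multiplied D⊨I) =
    ⊨⟨⟩-bounds (C-antitone D lhsI⊆lhsJ) D⊨I (C-antitone D J⊆I)

record CountermodelSizes (p q m : ℕ) : Set where
  field
    w u y : ℕ
    premise-outside : p ℕ.* (u ℕ.+ m ℕ.* y) ℕ.≤ u ℕ.* q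
    premise-inside : p ℕ.* (w ℕ.+ (u ℕ.+ m ℕ.* y)) ℕ.≤ (u ℕ.+ y) ℕ.* q
    conclusion-fails : u ℕ.* q ℕ.< p ℕ.* (w ℕ.+ u)

-- Writing a = pm and q = p + r, w = ra + 1 is the least w with p(w + u) > uq;
-- the slack pm < q then absorbs the m blocks of size y = p.
countermodelSizes : ∀ {p q m} → 0 ℕ.< p → p ℕ.< q → p ℕ.* m ℕ.< q → CountermodelSizes p q m
countermodelSizes {p} {q} {m} 0<p p<q pm<q with m≤n⇒∃[o]m+o≡n (<⇒≤ p<q)
... | r , refl = record
  { w = r ℕ.* a ℕ.+ 1
  ; u = p ℕ.* a
  ; y = p
  ; premise-outside = begin
      p ℕ.* (p ℕ.* a ℕ.+ m ℕ.* p)  ≡⟨ outside-≡ p m ⟩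
      p ℕ.* a ℕ.* (1 ℕ.+ p)        ≤⟨ *-monoʳ-≤ (p ℕ.* a) p<q ⟩
      p ℕ.* a ℕ.* (p ℕ.+ r)        ∎
  ; premise-inside = begin
      p ℕ.* ((r ℕ.* a ℕ.+ 1) ℕ.+ (p ℕ.* a ℕ.+ m ℕ.* p))  ≡⟨ inside-≡ p r m ⟩
      p ℕ.* a ℕ.* (p ℕ.+ r) ℕ.+ p ℕ.* (1 ℕ.+ a)          ≤⟨ +-monoʳ-≤ (p ℕ.* a ℕ.* (p ℕ.+ r)) (*-monoʳ-≤ p pm<q) ⟩
      p ℕ.* a ℕ.* (p ℕ.+ r) ℕ.+ p ℕ.* (p ℕ.+ r)          ≡⟨ *-distribʳ-+ (p ℕ.+ r) (p ℕ.* a) p ⟨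
      (p ℕ.* a ℕ.+ p) ℕ.* (p ℕ.+ r)                      ∎
  ; conclusion-fails = begin-strict
      p ℕ.* a ℕ.* (p ℕ.+ r)                 <⟨ m<m+n (p ℕ.* a ℕ.* (p ℕ.+ r)) 0<p ⟩
      p ℕ.* a ℕ.* (p ℕ.+ r) ℕ.+ p           ≡⟨ refuting-≡ p r m ⟩
      p ℕ.* ((r ℕ.* a ℕ.+ 1) ℕ.+ p ℕ.* a)   ∎
  }
  where
  open ≤-Reasoning
  a : ℕ
  a = p ℕ.* m
  outside-≡ : ∀ p m → p ℕ.* (p ℕ.* (p ℕ.* m) ℕ.+ m ℕ.* p) ≡ p ℕ.* (p ℕ.* m) ℕ.* (1 ℕ.+ p)
  outside-≡ = solve-∀
  inside-≡ : ∀ p r m → p ℕ.* ((r ℕ.* (p ℕ.* m) ℕ.+ 1) ℕ.+ (p ℕ.* (p ℕ.* m) ℕ.+ m ℕ.* p))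
                     ≡ p ℕ.* (p ℕ.* m) ℕ.* (p ℕ.+ r) ℕ.+ p ℕ.* (1 ℕ.+ p ℕ.* m)
  inside-≡ = solve-∀
  refuting-≡ : ∀ p r m → p ℕ.* (p ℕ.* m) ℕ.* (p ℕ.+ r) ℕ.+ p
                       ≡ p ℕ.* ((r ℕ.* (p ℕ.* m) ℕ.+ 1) ℕ.+ p ℕ.* (p ℕ.* m))
  refuting-≡ = solve-∀

module Countermodel {n m : ℕ} (w u y : ℕ) (X₀ : Subset n) (T : Fin m → Subset n) where

  dataset : DataSet n
  dataset = replicate w X₀ ++ replicate u ⊤ ++ blocks y T

  C-dataset : ∀ V → C dataset V ≡ C (replicate w X₀) V ℕ.+ (u ℕ.+ C (blocks y T) V)
  C-dataset V = begin
    C dataset V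
      ≡⟨ C-++ (replicate w X₀) _ V ⟩
    C (replicate w X₀) V ℕ.+ C (replicate u ⊤ ++ blocks y T) V
      ≡⟨ cong (C (replicate w X₀) V ℕ.+_) (C-++ (replicate u ⊤) (blocks y T) V) ⟩
    C (replicate w X₀) V ℕ.+ (C (replicate u ⊤) V ℕ.+ C (blocks y T) V)
      ≡⟨ cong (λ c → C (replicate w X₀) V ℕ.+ (c ℕ.+ C (blocks y T) V)) (C-replicate u ⊆⊤) ⟩
    C (replicate w X₀) V ℕ.+ (u ℕ.+ C (blocks y T) V)
      ∎
    where open ≡-Reasoning

  private
    C-replicate-⊈ : ∀ {V} → ¬ V ⊆ X₀ → C (replicate w X₀) V ≡ 0
    C-replicate-⊈ V⊈X₀ = C-none (All.replicate⁺ w V⊈X₀)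

    C-blocks≤ : ∀ V → C (blocks y T) V ℕ.≤ m ℕ.* y
    C-blocks≤ V = subst (C (blocks y T) V ℕ.≤_) (length-blocks y T) (C≤length (blocks y T) V)

  u≤C-dataset : ∀ V → u ℕ.≤ C dataset V
  u≤C-dataset V = subst (u ℕ.≤_) (sym (C-dataset V))
    (≤-trans (m≤m+n u (C (blocks y T) V)) (m≤n+m _ (C (replicate w X₀) V)))

  C-dataset≤ : ∀ V → C dataset V ℕ.≤ w ℕ.+ (u ℕ.+ m ℕ.* y)
  C-dataset≤ V = subst (ℕ._≤ w ℕ.+ (u ℕ.+ m ℕ.* y)) (sym (C-dataset V))
    (+-mono-≤ (subst (C (replicate w X₀) V ℕ.≤_) (length-replicate w) (C≤length (replicate w X₀) V))
              (+-monoʳ-≤ u (C-blocks≤ V)))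

  C-dataset-⊈ : ∀ {V} → ¬ V ⊆ X₀ → C dataset V ℕ.≤ u ℕ.+ m ℕ.* y
  C-dataset-⊈ {V} V⊈X₀ rewrite C-dataset V | C-replicate-⊈ V⊈X₀ = +-monoʳ-≤ u (C-blocks≤ V)

  C-dataset-block : ∀ {V} i → V ⊆ T i → u ℕ.+ y ℕ.≤ C dataset V
  C-dataset-block {V} i V⊆Tᵢ rewrite C-dataset V =
    ≤-trans (+-monoʳ-≤ u (C-blocks y T V i V⊆Tᵢ)) (m≤n+m _ (C (replicate w X₀) V))

  C-dataset-X₀ : w ℕ.+ u ℕ.≤ C dataset X₀
  C-dataset-X₀ rewrite C-dataset X₀ | C-replicate w {X = X₀} id =
    +-monoʳ-≤ w (m≤m+n u (C (blocks y T) X₀))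

  C-dataset-avoiding : ∀ {V} → ¬ V ⊆ X₀ → (∀ i → ¬ V ⊆ T i) → C dataset V ≡ u
  C-dataset-avoiding {V} V⊈X₀ V⊈T
    rewrite C-dataset V | C-replicate-⊈ V⊈X₀ | C-none (All-blocks y T V⊈T) = +-identityʳ u

refutation : ∀ {n m p q} → 0 ℕ.< p → p ℕ.< q → p ℕ.* m ℕ.< q →
  (P : Fin m → PImp n) (J : PImp n) → ¬ Subsumed P J →
  Σ (DataSet n) λ D → (∀ i → D ⊨⟨ p / q ⟩ P i) × ¬ D ⊨⟨ p / q ⟩ J
refutation {n} {m} {p} {q} 0<p p<q pm<q P J ¬subsumed = dataset , premise , conclusion
  where
  open CountermodelSizes (countermodelSizes 0<p p<q pm<q)

  J⊈lhsJ : ¬ (lhs J ∪ rhs J) ⊆ lhs J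
  J⊈lhsJ J⊆ = ¬subsumed (inj₁ (⊆-trans (q⊆p∪q (lhs J) (rhs J)) J⊆))

  block : ∀ i → Σ (Subset n) λ T →
    ¬ (lhs J ∪ rhs J) ⊆ T × (lhs (P i) ⊆ lhs J → (lhs (P i) ∪ rhs (P i)) ⊆ T)
  block i with lhs (P i) ⊆? lhs J
  ... | yes Xᵢ⊆X₀ = lhs (P i) ∪ rhs (P i) , (λ J⊆ → ¬subsumed (inj₂ (i , Xᵢ⊆X₀ , J⊆))) , λ _ → id
  ... | no Xᵢ⊈X₀ = lhs J , J⊈lhsJ , λ Xᵢ⊆X₀ → ⊥-elim (Xᵢ⊈X₀ Xᵢ⊆X₀)

  open Countermodel w u y (lhs J) (proj₁ ∘ block)

  premise : ∀ i → dataset ⊨⟨ p / q ⟩ P i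
  premise i with lhs (P i) ⊆? lhs J
  ... | yes Xᵢ⊆X₀ = ⊨⟨⟩-bounds (C-dataset≤ _) premise-inside
                      (C-dataset-block i (proj₂ (proj₂ (block i)) Xᵢ⊆X₀))
  ... | no Xᵢ⊈X₀ = ⊨⟨⟩-bounds (C-dataset-⊈ Xᵢ⊈X₀) premise-outside (u≤C-dataset _)

  conclusion : ¬ dataset ⊨⟨ p / q ⟩ J
  conclusion (cross-multiplied D⊨J) = <⇒≱ conclusion-fails (begin
    p ℕ.* (w ℕ.+ u)                   ≤⟨ *-monoʳ-≤ p C-dataset-X₀ ⟩
    p ℕ.* C dataset (lhs J)           ≤⟨ D⊨J ⟩
    C dataset (lhs J ∪ rhs J) ℕ.* q   ≡⟨ cong (ℕ._* q) (C-dataset-avoiding J⊈lhsJ (proj₁ ∘ proj₂ ∘ block)) ⟩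
    u ℕ.* q                           ∎)
    where open ≤-Reasoning

⊩-single⇒⊩ : ∀ {n k γ} {P : Fin k → PImp n} {J : PImp n} →
  Σ (Fin k) (λ i → (λ (_ : Fin 1) → P i) ⊩[ γ ] J) → P ⊩[ γ ] J
⊩-single⇒⊩ (i , Pᵢ⊩J) D D⊨P = Pᵢ⊩J D (λ _ → D⊨P i)

module _ {n : ℕ} (p d : ℕ) .(c : Coprime p (suc d)) {J : PImp n} where

  private
    open module ⊨⇔ {D : DataSet n} {I : PImp n} = Equivalence (⊨⇔⊨⟨⟩ p d c {D} {I})

  subsumed⇒⊩-single : ∀ {k} {P : Fin (suc k) → PImp n} → p ℕ.≤ suc d → Subsumed P J →
    Σ (Fin (suc k)) λ i → (λ (_ : Fin 1) → P i) ⊩[ mkℚ (+ p) d c ] J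
  subsumed⇒⊩-single p≤q (inj₁ J-trivial) = zero , λ D _ → from (⊨⟨⟩-trivial {D = D} p≤q J-trivial)
  subsumed⇒⊩-single {P = P} p≤q (inj₂ (i , Pᵢ-subsumes-J)) =
    i , λ D D⊨Pᵢ → from (⊨⟨⟩-subsumes {I = P i} Pᵢ-subsumes-J (to {D} {P i} (D⊨Pᵢ zero)))

  ⊩⇒subsumed : ∀ {k} {P : Fin k → PImp n} → 0 ℕ.< p → p ℕ.< suc d → p ℕ.* k ℕ.< suc d →
    P ⊩[ mkℚ (+ p) d c ] J → Subsumed P J
  ⊩⇒subsumed {P = P} 0<p p<q pk<q P⊩J = decidable-stable (subsumed? P J) λ ¬subsumed →
    let D , D⊨P , D⊭J = refutation 0<p p<q pk<q P J ¬subsumed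
    in D⊭J (to {D} {J} (P⊩J D (λ i → from (D⊨P i))))

theorem4 : (n k : ℕ) (γ : ℚ) → 0ℚ < γ → γ < 1ℚ →
    (X₀ Y₀ : Subset n) (P : Fin (suc k) → PImp n) →
    γ * ℕ→ℚ (suc k) < 1ℚ →
    ((P ⊩[ γ ] (X₀ ⇒ Y₀)) ⇔ (Σ (Fin (suc k)) λ i → (λ (_ : Fin 1) → P i) ⊩[ γ ] (X₀ ⇒ Y₀)))
    × ((Σ (Fin (suc k)) λ i → (λ (_ : Fin 1) → P i) ⊩[ γ ] (X₀ ⇒ Y₀))
       ⇔ (Y₀ ⊆ X₀ ⊎ Σ (Fin (suc k)) λ i → lhs (P i) ⊆ X₀ × (X₀ ∪ Y₀) ⊆ (lhs (P i) ∪ rhs (P i))))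
theorem4 n k γ@(mkℚ (+ suc p) d c) _ _ X₀ Y₀ P γk<1 =
    mk⇔ (single ∘ subsumed) (⊩-single⇒⊩ {γ = γ})
  , mk⇔ (subsumed ∘ ⊩-single⇒⊩ {γ = γ}) single
  where
  pk<q : suc p ℕ.* suc k ℕ.< suc d
  pk<q = subst (suc p ℕ.* suc k ℕ.<_) (*-identityˡ (suc d)) (mkℚ*ℕ→ℚ-<⇒ (suc p) d c (suc k) 1 γk<1)

  p<q : suc p ℕ.< suc d
  p<q = ≤-<-trans (m≤m*n (suc p) (suc k)) pk<q

  subsumed : P ⊩[ γ ] (X₀ ⇒ Y₀) → Subsumed P (X₀ ⇒ Y₀)
  subsumed = ⊩⇒subsumed (suc p) d c z<s p<q pk<q

  single : Subsumed P (X₀ ⇒ Y₀) → Σ (Fin (suc k)) λ i → (λ (_ : Fin 1) → P i) ⊩[ γ ] (X₀ ⇒ Y₀)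
  single = subsumed⇒⊩-single (suc p) d c (<⇒≤ p<q)
theorem4 n k (mkℚ (+ 0) d c) (*<* (+<+ ())) _ _ _ _ _
theorem4 n k (mkℚ -[1+ _ ] d c) (*<* ()) _ _ _ _ _
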